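{- Under the condition $\left\lceil\frac{k_1}{k_2+\cdots+k_r}\right\rceil\ge (m-1)(i_r-1)$, an $m$-AP-block (of an $m$-AP-partition of $\mathbb{Z}_n$ of type $1^{k_1}i_2^{k_2}\cdots i_r^{k_r}$) is not uniquely determined by its underlying set if and only if $n=i_rm$ and it is of length $i_r$.
   Context: $\mathbb{Z}_n$ is the cyclic group of order $n$ with elements $1,2,\ldots,n$, viewed as a directed $n$-cycle. For a positive integer $m$, an $m$-AP-block (arithmetic progression block of difference $m$) of length $i$ is a sequence $(x, x+m, x+2m, \ldots, x+(i-1)m) \pmod n$; its first element $x$ is the head, and a block of length one is a singleton. An $m$-AP-partition of $\mathbb{Z}_n$ is a set of $m$-AP-blocks whose underlying sets form a partition of $\mathbb{Z}_n$. Its type is written $i_1^{k_1}i_2^{k_2}\cdots i_r^{k_r}$ with $1\le i_1<i_2<\cdots<i_r$ and all $k_j\ge1$, meaning there are $k_j$ blocks of size $i_j$ (so $n=\sum_j k_j i_j$). Throughout, attention is restricted to partitions having at least one singleton and at least one non-singleton block, i.e. $i_1=1$ and $r\ge2$. Different AP-blocks (as sequences) may have the same underlying set; "uniquely determined by its underlying set" means no other $m$-AP-block (different as a sequence) has the same underlying set. $\lceil x\rceil$ denotes the smallest integer greater than or equal to $x$. For $m\ge2$ the condition is equivalent to $k_1\ge(k_2+\cdots+k_r)[(m-1)(i_r-1)-1]+1$. -}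

module Defs where

open import Data.Nat using (ℕ; zero; suc; _+_; _*_; _∸_; _≤_; _<_; NonZero)
open import Data.Nat.DivMod using (_/_; _mod_)
open import Data.Fin as Fin using (Fin; toℕ; fromℕ)
open import Data.List using (List; map; upTo; concatMap; allFin; filter; length)
open import Data.Nat.ListAction using (sum)
open import Data.List.Relation.Unary.All using (All)
open import Data.List.Membership.Propositional using (_∈_)
open import Data.List.Relation.Binary.Permutation.Propositional using (_↭_)
open import Data.Product using (Σ; ∃; _×_)
open import Relation.Binary.PropositionalEquality using (_≡_; _≢_)
open import Function.Bundles using (_⇔_)
import Data.Nat.Properties as ℕP

-- Z_n is represented by Fin n (residues 0,…,n-1; the paper's labels 1,…,n
-- are a relabelling, with n ≡ 0).

record Block (n : ℕ) : Set where
  constructor block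
  field
    head : Fin n
    len  : ℕ
open Block public

seq : {n : ℕ} {{_ : NonZero n}} → ℕ → Block n → List (Fin n)
seq {n} m B = map (λ j → (toℕ (head B) + j * m) mod n) (upTo (len B))

IsAPBlock : {n : ℕ} → Block n → Set
IsAPBlock B = 1 ≤ len B

-- An m-AP-partition of Z_n: a collection of m-AP-blocks such that every
-- element of Z_n occurs exactly once among all entries of all blocks
-- (so the underlying sets partition Z_n and block size = length).
IsAPPartition : {n : ℕ} {{_ : NonZero n}} → ℕ → List (Block n) → Set
IsAPPartition {n} m P = All IsAPBlock P × (concatMap (seq m) P ↭ allFin n)

NotUniquelyDetermined : {n : ℕ} {{_ : NonZero n}} → ℕ → Block n → Set
NotUniquelyDetermined {n} m B =
  Σ (Block n) λ B' → IsAPBlock B' × (seq m B' ≢ seq m B) ×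
    ((y : Fin n) → (y ∈ seq m B') ⇔ (y ∈ seq m B))

-- The type  i₁^{k₁} i₂^{k₂} ⋯ i_r^{k_r}  with r = suc (suc r') ≥ 2 parts,
-- i₁ = 1, i strictly increasing, all kⱼ ≥ 1, exactly kⱼ blocks of length iⱼ,
-- and every block has one of the lengths iⱼ.
HasType : {n : ℕ} → List (Block n) → (r' : ℕ) →
          (i k : Fin (suc (suc r')) → ℕ) → Set
HasType P r' i k =
  (i Fin.zero ≡ 1) ×
  ((a b : Fin (suc (suc r'))) → a Fin.< b → i a < i b) ×
  ((j : Fin (suc (suc r'))) → 1 ≤ k j) ×
  ((j : Fin (suc (suc r'))) →
     length (filter (λ B → len B ℕP.≟ i j) P) ≡ k j) ×
  All (λ B → ∃ λ j → len B ≡ i j) P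

-- Ceiling division ⌈a / b⌉ (set to 0 for b = 0, which never occurs here).
⌈_/_⌉ : ℕ → ℕ → ℕ
⌈ a / zero ⌉ = 0
⌈ a / suc b ⌉ = (a + b) / suc b

lastPart : (r' : ℕ) → (Fin (suc (suc r')) → ℕ) → ℕ
lastPart r' i = i (fromℕ (suc r'))

restSum : (r' : ℕ) → (Fin (suc (suc r')) → ℕ) → ℕ
restSum r' k = sum (map (λ j → k (Fin.suc j)) (allFin (suc r')))

module Submission where

-- Let B be a block of an m-AP-partition of ℤ_n, with head x and length L.
-- Write ap x j = x + j·m (mod n) for the j-th term, so B lists ap x 0, …, ap x (L-1).
--
-- 1. Rigidity.  If the terms of B are distinct and n ∤ L·m (the progression
--    does not close up after L steps), then every m-AP-block with the same
--    underlying set has the same head and length: it must start at x, since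
--    otherwise the progression would return to x within L steps, and it can
--    neither stop earlier nor run further.  Conversely, if n ∣ L·m, the block
--    of length L+1 with head x has the same underlying set.  Hence, inside a
--    partition, B is not uniquely determined iff n ∣ L·m.
-- 2. Arithmetic.  If n ∣ L·m, no block of the partition is longer than L
--    (it would repeat its first element), so L = i_r.  Counting elements gives
--    k₁ + i_r ≤ n, and the hypothesis gives k₁ ≥ (m-1)(i_r-1); together
--    0 < i_r·m < 2n, so n ∣ i_r·m forces n = i_r·m.

open import Defs
open import Data.Nat using (ℕ; zero; suc; _+_; _*_; _∸_; _≤_; _<_; _≥_; NonZero; z≤n; s≤s; _%_)
open import Data.Nat.Properties
open import Data.Nat.DivMod using (_mod_; %-distribˡ-+; %-remove-+ʳ; [m+kn]%n≡m%n; m%n≤m; m<n⇒m%n≡m; m<n⇒m/n≡0; /-monoˡ-≤; m*n/n≡m)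
open import Data.Nat.Divisibility using (_∣_; divides; _∣?_; ∣-refl; m%n≡0⇒n∣m)
open import Data.Nat.ListAction using (sum)
open import Data.Nat.Tactic.RingSolver using (solve-∀)
open import Data.Fin using (Fin; toℕ; fromℕ)
import Data.Fin as Fin
import Data.Fin.Properties as FinP
open import Data.List using (List; []; _∷_; _++_; map; upTo; concatMap; filter; length)
open import Data.List.Properties using (length-++; length-map; length-upTo; length-tabulate; filter-accept; filter-reject)
open import Data.List.Membership.Propositional using (_∈_)
open import Data.List.Membership.Propositional.Properties using (∈-map⁺; ∈-map⁻; ∈-upTo⁺; ∈-upTo⁻; ∈-filter⁻)
open import Data.List.Relation.Unary.Any using (here; there)
import Data.List.Relation.Unary.All as All
open import Data.List.Relation.Unary.All.Properties using (++⁻ˡ)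
open import Data.List.Relation.Unary.AllPairs using ([]; _∷_)
open import Data.List.Relation.Unary.Unique.Propositional using (Unique)
open import Data.List.Relation.Unary.Unique.Propositional.Properties using (allFin⁺)
open import Data.List.Relation.Binary.Permutation.Propositional using (↭⇒↭ₛ; ↭-sym)
open import Data.List.Relation.Binary.Permutation.Propositional.Properties using (↭-length)
import Data.List.Relation.Binary.Permutation.Setoid.Properties as PermutationS
open import Data.Product using (∃; _×_; _,_; proj₁; proj₂)
open import Data.Sum using (inj₁; inj₂)
open import Data.Empty using (⊥-elim)
open import Relation.Nullary using (¬_; yes; no)
open import Relation.Unary using (Decidable)
open import Relation.Binary.PropositionalEquality
open import Function.Bundles using (_⇔_; mk⇔; Equivalence)
open import Function.Construct.Composition using (_⇔-∘_)

+-%-congʳ : ∀ n .{{_ : NonZero n}} {u v} w → u % n ≡ v % n → (u + w) % n ≡ (v + w) % n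
+-%-congʳ n {u} {v} w u≡v = begin
  (u + w) % n          ≡⟨ %-distribˡ-+ u w n ⟩
  (u % n + w % n) % n  ≡⟨ cong (λ z → (z + w % n) % n) u≡v ⟩
  (v % n + w % n) % n  ≡⟨ %-distribˡ-+ v w n ⟨
  (v + w) % n          ∎
  where open ≡-Reasoning

-- Adding w and then (n-1)·w adds n·w, which is invisible mod n.
+-%-cancelʳ : ∀ n .{{_ : NonZero n}} {u v} w → (u + w) % n ≡ (v + w) % n → u % n ≡ v % n
+-%-cancelʳ n@(suc n-1) {u} {v} w e = begin
  u % n                  ≡⟨ [m+kn]%n≡m%n u w n ⟨
  (u + w * n) % n        ≡⟨ cong (_% n) (regroup u w n-1) ⟩
  (u + w + n-1 * w) % n  ≡⟨ +-%-congʳ n {u + w} {v + w} (n-1 * w) e ⟩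
  (v + w + n-1 * w) % n  ≡⟨ cong (_% n) (regroup v w n-1) ⟨
  (v + w * n) % n        ≡⟨ [m+kn]%n≡m%n v w n ⟩
  v % n                  ∎
  where
  open ≡-Reasoning
  regroup : ∀ z w k → z + w * suc k ≡ z + w + k * w
  regroup = solve-∀

Unique-++⁻ : ∀ {A : Set} (xs : List A) {ys} → Unique (xs ++ ys) → Unique xs × Unique ys
Unique-++⁻ []       u          = [] , u
Unique-++⁻ (x ∷ xs) (x∉ ∷ u) with Unique-++⁻ xs u
... | uxs , uys = (++⁻ˡ xs x∉ ∷ uxs) , uys

Unique-concatMap⁻ : ∀ {A B : Set} (h : A → List B) {xs a} → Unique (concatMap h xs) → a ∈ xs → Unique (h a)
Unique-concatMap⁻ h {a ∷ _} u (here refl) = proj₁ (Unique-++⁻ (h a) u)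
Unique-concatMap⁻ h {a ∷ _} u (there a∈)  = Unique-concatMap⁻ h (proj₂ (Unique-++⁻ (h a) u)) a∈

Unique-map⇒injective : ∀ {A B : Set} (g : A → B) {xs a b} → Unique (map g xs) →
                       a ∈ xs → b ∈ xs → g a ≡ g b → a ≡ b
Unique-map⇒injective g _            (here refl) (here refl) _ = refl
Unique-map⇒injective g (ga≢ ∷ _)   (here refl) (there b∈)  e = ⊥-elim (All.lookup ga≢ (∈-map⁺ g b∈) e)
Unique-map⇒injective g (gb≢ ∷ _)   (there a∈)  (here refl) e = ⊥-elim (All.lookup gb≢ (∈-map⁺ g a∈) (sym e))
Unique-map⇒injective g (_ ∷ u)     (there a∈)  (there b∈)  e = Unique-map⇒injective g u a∈ b∈ e

module Sizes {A : Set} (size : A → ℕ) where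

  singletons : List A → ℕ
  singletons xs = length (filter (λ a → size a ≟ 1) xs)

  total : List A → ℕ
  total xs = sum (map size xs)

  singletons≤total : ∀ xs → singletons xs ≤ total xs
  singletons≤total []       = z≤n
  singletons≤total (a ∷ xs) with size a ≟ 1
  ... | yes a≡1 = begin
    singletons (a ∷ xs)  ≡⟨ cong length (filter-accept (λ b → size b ≟ 1) a≡1) ⟩
    suc (singletons xs)  ≤⟨ s≤s (singletons≤total xs) ⟩
    1 + total xs         ≡⟨ cong (_+ total xs) a≡1 ⟨
    total (a ∷ xs)       ∎
    where open ≤-Reasoning
  ... | no a≢1 = begin
    singletons (a ∷ xs)  ≡⟨ cong length (filter-reject (λ b → size b ≟ 1) a≢1) ⟩
    singletons xs        ≤⟨ singletons≤total xs ⟩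
    total xs             ≤⟨ m≤n+m (total xs) (size a) ⟩
    total (a ∷ xs)       ∎
    where open ≤-Reasoning

  singletons+size≤total : ∀ {a xs} → a ∈ xs → size a ≢ 1 → singletons xs + size a ≤ total xs
  singletons+size≤total {a} {.a ∷ xs} (here refl) a≢1 = begin
    singletons (a ∷ xs) + size a  ≡⟨ cong (λ c → length c + size a) (filter-reject (λ b → size b ≟ 1) a≢1) ⟩
    singletons xs + size a        ≤⟨ +-monoˡ-≤ (size a) (singletons≤total xs) ⟩
    total xs + size a             ≡⟨ +-comm (total xs) (size a) ⟩
    total (a ∷ xs)                ∎
    where open ≤-Reasoning
  singletons+size≤total {a} {b ∷ xs} (there a∈) a≢1 with size b ≟ 1
  ... | yes b≡1 = begin
    singletons (b ∷ xs) + size a  ≡⟨ cong (λ c → length c + size a) (filter-accept (λ c → size c ≟ 1) b≡1) ⟩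
    suc (singletons xs + size a)  ≤⟨ s≤s (singletons+size≤total a∈ a≢1) ⟩
    1 + total xs                  ≡⟨ cong (_+ total xs) b≡1 ⟨
    total (b ∷ xs)                ∎
    where open ≤-Reasoning
  ... | no b≢1 = begin
    singletons (b ∷ xs) + size a  ≡⟨ cong (λ c → length c + size a) (filter-reject (λ c → size c ≟ 1) b≢1) ⟩
    singletons xs + size a        ≤⟨ singletons+size≤total a∈ a≢1 ⟩
    total xs                      ≤⟨ m≤n+m (total xs) (size b) ⟩
    total (b ∷ xs)                ∎
    where open ≤-Reasoning

nonempty-member : ∀ {A : Set} (ys : List A) → 1 ≤ length ys → ∃ (_∈ ys)
nonempty-member (y ∷ _) _ = y , here refl

filter-witness : ∀ {A : Set} {Q : A → Set} (Q? : Decidable Q) xs →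
                 1 ≤ length (filter Q? xs) → ∃ λ a → a ∈ xs × Q a
filter-witness Q? xs h with nonempty-member (filter Q? xs) h
... | a , a∈filter = a , ∈-filter⁻ Q? a∈filter

-- ⌈a / b⌉ ≤ a, since a + (b - 1) ≤ a·b for b ≥ 1.
⌈/⌉≤ : ∀ a b → ⌈ a / b ⌉ ≤ a
⌈/⌉≤ a       zero    = z≤n
⌈/⌉≤ zero    (suc b) = ≤-reflexive (m<n⇒m/n≡0 (n<1+n b))
⌈/⌉≤ (suc a) (suc b) = ≤-trans (/-monoˡ-≤ (suc b) a+b≤ab) (≤-reflexive (m*n/n≡m (suc a) (suc b)))
  where
  a+b≤ab : suc a + b ≤ suc a * suc b
  a+b≤ab = subst (suc a + b ≤_) (sym (*-suc (suc a) b)) (+-monoʳ-≤ (suc a) (m≤n*m b (suc a)))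

-- I·m = ((m-1)(I-1) + I) + (m-1); both summands are below n when
-- (m-1)(I-1) + I ≤ n and I ≥ 2.
<2*-bound : ∀ {n m I} → 1 ≤ m → 2 ≤ I → (m ∸ 1) * (I ∸ 1) + I ≤ n → I * m < n + n
<2*-bound {n} {suc μ} {suc zero}    _ (s≤s ()) _
<2*-bound {n} {suc μ} {suc (suc ι)} _ _        fits = begin-strict
  suc (suc ι) * suc μ            ≡⟨ expand ι μ ⟩
  (μ * suc ι + suc (suc ι)) + μ  <⟨ +-mono-≤-< fits μ<n ⟩
  n + n                          ∎
  where
  open ≤-Reasoning
  expand : ∀ ι μ → suc (suc ι) * suc μ ≡ (μ * suc ι + suc (suc ι)) + μ
  expand = solve-∀
  μ<n : μ < n
  μ<n = ≤-<-trans (m≤m*n μ (suc ι)) (<-≤-trans (m<m+n (μ * suc ι) (s≤s z≤n)) fits)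

∣-between : ∀ {n a} → n ∣ a → 0 < a → a < n + n → a ≡ n
∣-between     (divides zero          refl) () _
∣-between {n} (divides (suc zero)    refl) _  _     = +-identityʳ n
∣-between {n} (divides (suc (suc q)) refl) _  a<2n =
  ⊥-elim (<⇒≱ a<2n (+-monoʳ-≤ n (m≤m+n n (q * n))))

module Progression (n : ℕ) {{_ : NonZero n}} (m : ℕ) where

  ap : ℕ → ℕ → ℕ
  ap x j = (x + j * m) % n

  advance : ∀ x c j → x + (c + j) * m ≡ x + j * m + c * m
  advance x c j = trans (cong (x +_) (trans (*-distribʳ-+ m c j) (+-comm (c * m) (j * m))))
                        (sym (+-assoc x (j * m) (c * m)))

  ap-shift : ∀ {x y j k} c → ap x j ≡ ap y k → ap x (c + j) ≡ ap y (c + k)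
  ap-shift {x} {y} {j} {k} c e =
    trans (cong (_% n) (advance x c j))
          (trans (+-%-congʳ n {x + j * m} {y + k * m} (c * m) e) (cong (_% n) (sym (advance y c k))))

  ap-unshift : ∀ {x y j k} c → ap x (c + j) ≡ ap y (c + k) → ap x j ≡ ap y k
  ap-unshift {x} {y} {j} {k} c e = +-%-cancelʳ n {x + j * m} {y + k * m} (c * m)
    (trans (cong (_% n) (sym (advance x c j))) (trans e (cong (_% n) (advance y c k))))

  ap-start : ∀ x → ap x 0 ≡ x % n
  ap-start x = cong (_% n) (+-identityʳ x)

  period⁺ : ∀ {x L} → n ∣ L * m → ap x L ≡ ap x 0
  period⁺ {x} n∣Lm = trans (%-remove-+ʳ x n∣Lm) (sym (ap-start x))

  period⁻ : ∀ {x L} → ap x L ≡ ap x 0 → n ∣ L * m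
  period⁻ {x} {L} e = m%n≡0⇒n∣m (L * m) n
    (trans (+-%-cancelʳ n {L * m} {0} x (trans (cong (_% n) (+-comm (L * m) x)) (trans e (ap-start x))))
           (n≤0⇒n≡0 (m%n≤m 0 n)))

  module Rigidity {x y L L' : ℕ}
    (injective : ∀ {a b} → a < L → b < L → ap x a ≡ ap x b → a ≡ b)
    (no-period : ¬ n ∣ L * m) (L≥1 : 1 ≤ L)
    (values⊆ : ∀ {t} → t < L' → ∃ λ a → a < L × ap y t ≡ ap x a)
    (values⊇ : ∀ {a} → a < L → ∃ λ t → t < L' × ap x a ≡ ap y t) where

    no-return : ∀ {c} → 0 < c → c ≤ L → ap x c ≢ ap x 0
    no-return 0<c c≤L e with m≤n⇒m<n∨m≡n c≤L
    ... | inj₁ c<L  = <⇒≢ 0<c (sym (injective c<L L≥1 e))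
    ... | inj₂ refl = no-period (period⁻ {x} {L} e)

    -- If x were the (t+1)-th value of the y-segment, its t-th value would be
    -- some ap x a, and then ap x (a+1) = ap x 0.
    same-first : ap y 0 ≡ ap x 0
    same-first with values⊇ L≥1
    ... | zero  , _      , e = sym e
    ... | suc t , t+1<L' , e with values⊆ (<-trans (n<1+n t) t+1<L')
    ...   | a , a<L , e' = ⊥-elim (no-return (s≤s z≤n) a<L (sym (trans e (ap-shift {y} {x} {t} {a} 1 e'))))

    same-terms : ∀ t → ap y t ≡ ap x t
    same-terms t = subst₂ (λ u v → ap y u ≡ ap x v) (+-identityʳ t) (+-identityʳ t)
                          (ap-shift {y} {x} {0} {0} t same-first)

    -- If L < L', then ap x L = ap y L = ap x a for some a < L, so the segment
    -- returns to its start after L - a steps.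
    L'≤L : L' ≤ L
    L'≤L with L' ≤? L
    ... | yes L'≤L = L'≤L
    ... | no L'≰L with values⊆ (≰⇒> L'≰L)
    ...   | a , a<L , e = ⊥-elim (no-return (m<n⇒0<n∸m a<L) (m∸n≤m L a) (ap-unshift {x} {x} {L ∸ a} {0} a back))
      where
      back : ap x (a + (L ∸ a)) ≡ ap x (a + 0)
      back = subst₂ (λ u v → ap x u ≡ ap x v) (sym (m+[n∸m]≡n (<⇒≤ a<L))) (sym (+-identityʳ a))
                    (trans (sym (same-terms L)) e)

    -- If L' < L, then ap x L' = ap y t = ap x t for some t < L', against injectivity.
    L≤L' : L ≤ L'
    L≤L' with L ≤? L'
    ... | yes L≤L' = L≤L'
    ... | no L≰L' with values⊇ (≰⇒> L≰L')
    ...   | t , t<L' , e = ⊥-elim (<⇒≢ t<L' (sym (injective L'<L (<-trans t<L' L'<L) (trans e (same-terms t)))))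
      where
      L'<L : L' < L
      L'<L = ≰⇒> L≰L'

    same-start : y % n ≡ x % n
    same-start = trans (sym (ap-start y)) (trans same-first (ap-start x))

module Blocks (n : ℕ) {{_ : NonZero n}} (m : ℕ) where
  open Progression n m

  start : Block n → ℕ
  start B = toℕ (head B)

  term : Block n → ℕ → Fin n
  term B j = (start B + j * m) mod n

  toℕ-term : ∀ B j → toℕ (term B j) ≡ ap (start B) j
  toℕ-term B j = FinP.toℕ-fromℕ< _

  length-seq : ∀ B → length (seq m B) ≡ len B
  length-seq B = trans (length-map (term B) (upTo (len B))) (length-upTo (len B))

  ∈-seq⁻ : ∀ {B y} → y ∈ seq m B → ∃ λ j → j < len B × toℕ y ≡ ap (start B) j
  ∈-seq⁻ {B} y∈ with ∈-map⁻ (term B) y∈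
  ... | j , j∈ , refl = j , ∈-upTo⁻ j∈ , toℕ-term B j

  ∈-seq⁺ : ∀ {B y j} → j < len B → toℕ y ≡ ap (start B) j → y ∈ seq m B
  ∈-seq⁺ {B} {y} {j} j<len e =
    subst (_∈ seq m B) (FinP.toℕ-injective (trans (toℕ-term B j) (sym e)))
          (∈-map⁺ (term B) (∈-upTo⁺ j<len))

  values⊆ : ∀ {B C} → (∀ y → y ∈ seq m B → y ∈ seq m C) →
            ∀ {t} → t < len B → ∃ λ a → a < len C × ap (start B) t ≡ ap (start C) a
  values⊆ {B} B⊆C {t} t<len with ∈-seq⁻ (B⊆C _ (∈-seq⁺ {B} t<len (toℕ-term B t)))
  ... | a , a<len , e = a , a<len , trans (sym (toℕ-term B t)) e

  Distinct : Block n → Set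
  Distinct B = ∀ {a b} → a < len B → b < len B → ap (start B) a ≡ ap (start B) b → a ≡ b

  nud⇒period : ∀ {B} → Distinct B → 1 ≤ len B → NotUniquelyDetermined m B → n ∣ len B * m
  nud⇒period {B} distinct L≥1 (B' , _ , B'≢B , sameSet) with n ∣? len B * m
  ... | yes n∣Lm = n∣Lm
  ... | no  n∤Lm = ⊥-elim (B'≢B (cong (seq m) (cong₂ block same-head L'≡L)))
    where
    open Rigidity distinct n∤Lm L≥1
      (values⊆ {B'} λ y → Equivalence.to (sameSet y))
      (values⊆ {B} λ y → Equivalence.from (sameSet y))
    L'≡L : len B' ≡ len B
    L'≡L = ≤-antisym L'≤L L≤L'
    same-head : head B' ≡ head B
    same-head = FinP.toℕ-injective
      (trans (sym (m<n⇒m%n≡m (FinP.toℕ<n (head B')))) (trans same-start (m<n⇒m%n≡m (FinP.toℕ<n (head B)))))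

  -- If the block closes up, extending it by one step repeats its head and
  -- gives a different m-AP-block with the same underlying set.
  period⇒nud : ∀ {B} → 1 ≤ len B → n ∣ len B * m → NotUniquelyDetermined m B
  period⇒nud {B} L≥1 n∣Lm = extended , s≤s z≤n , longer , λ y → mk⇔ (shrink y) (grow y)
    where
    L : ℕ
    L = len B
    extended : Block n
    extended = block (head B) (suc L)
    longer : seq m extended ≢ seq m B
    longer e = 1+n≢n (trans (sym (length-seq extended)) (trans (cong length e) (length-seq B)))
    shrink : ∀ y → y ∈ seq m extended → y ∈ seq m B
    shrink y y∈ with ∈-seq⁻ {extended} y∈
    ... | j , j<L+1 , e with m≤n⇒m<n∨m≡n (≤-pred j<L+1)
    ...   | inj₁ j<L  = ∈-seq⁺ {B} j<L e
    ...   | inj₂ refl = ∈-seq⁺ {B} L≥1 (trans e (period⁺ {start B} {L} n∣Lm))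
    grow : ∀ y → y ∈ seq m B → y ∈ seq m extended
    grow y y∈ with ∈-seq⁻ {B} y∈
    ... | j , j<L , e = ∈-seq⁺ {extended} (<-trans j<L (n<1+n L)) e

module Partitions (n : ℕ) {{_ : NonZero n}} (m : ℕ) {P : List (Block n)} (isPartition : IsAPPartition m P) where
  open Progression n m
  open Blocks n m

  -- All entries of all blocks together are a permutation of ℤ_n, hence distinct.
  entries-unique : Unique (concatMap (seq m) P)
  entries-unique = PermutationS.Unique-resp-↭ (setoid (Fin n)) (↭⇒↭ₛ (↭-sym (proj₂ isPartition))) (allFin⁺ n)

  blocks-distinct : ∀ {C} → C ∈ P → Distinct C
  blocks-distinct {C} C∈P {a} {b} a<len b<len e =
    Unique-map⇒injective (term C) (Unique-concatMap⁻ (seq m) entries-unique C∈P)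
      (∈-upTo⁺ a<len) (∈-upTo⁺ b<len)
      (FinP.toℕ-injective (trans (toℕ-term C a) (trans e (sym (toℕ-term C b)))))

  -- If n ∣ L·m with L ≥ 1, no block is longer than L: it would repeat its
  -- head after L steps.
  blocks-within-period : ∀ {C L} → C ∈ P → 1 ≤ L → n ∣ L * m → len C ≤ L
  blocks-within-period {C} {L} C∈P L≥1 n∣Lm with len C ≤? L
  ... | yes len≤L = len≤L
  ... | no  len≰L = ⊥-elim (<⇒≢ L≥1 (sym L≡0))
    where
    L<len : L < len C
    L<len = ≰⇒> len≰L
    L≡0 : L ≡ 0
    L≡0 = blocks-distinct C∈P L<len (≤-<-trans z≤n L<len) (period⁺ {start C} {L} n∣Lm)

  total-length : sum (map len P) ≡ n
  total-length = trans (sym (length-entries P)) (trans (↭-length (proj₂ isPartition)) (length-tabulate _))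
    where
    length-entries : ∀ Q → length (concatMap (seq m) Q) ≡ sum (map len Q)
    length-entries []      = refl
    length-entries (C ∷ Q) = trans (length-++ (seq m C)) (cong₂ _+_ (length-seq C) (length-entries Q))

  nud⇔period : ∀ {B} → B ∈ P → NotUniquelyDetermined m B ⇔ n ∣ len B * m
  nud⇔period {B} B∈P = mk⇔ (nud⇒period (blocks-distinct B∈P) L≥1) (period⇒nud L≥1)
    where
    L≥1 : 1 ≤ len B
    L≥1 = All.lookup (proj₁ isPartition) B∈P

module TypeFacts {n : ℕ} {P : List (Block n)} {r' : ℕ} {i k : Fin (suc (suc r')) → ℕ}
                 (hasType : HasType P r' i k) where
  open Sizes (len {n})

  I : ℕ
  I = lastPart r' i

  largest : Fin (suc (suc r'))
  largest = fromℕ (suc r')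

  i₁≡1 : i Fin.zero ≡ 1
  i₁≡1 = proj₁ hasType

  increasing : ∀ a b → a Fin.< b → i a < i b
  increasing = proj₁ (proj₂ hasType)

  block-counts : ∀ j → length (filter (λ B → len B ≟ i j) P) ≡ k j
  block-counts = proj₁ (proj₂ (proj₂ (proj₂ hasType)))

  part≤largest : ∀ j → i j ≤ I
  part≤largest j with j FinP.≟ largest
  ... | yes refl    = ≤-refl
  ... | no  j≢last = <⇒≤ (increasing j largest (FinP.≤∧≢⇒< (FinP.≤fromℕ j) j≢last))

  block≤largest : ∀ {B} → B ∈ P → len B ≤ I
  block≤largest B∈P with All.lookup (proj₂ (proj₂ (proj₂ (proj₂ hasType)))) B∈P
  ... | j , len≡ij = subst (_≤ I) (sym len≡ij) (part≤largest j)

  largest≥2 : 2 ≤ I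
  largest≥2 = subst (_< I) i₁≡1 (increasing Fin.zero largest (s≤s z≤n))

  -- k_r ≥ 1, so some block has the largest length.
  largest-occurs : ∃ λ C → C ∈ P × len C ≡ I
  largest-occurs = filter-witness (λ B → len B ≟ I) P
    (subst (1 ≤_) (sym (block-counts largest)) (proj₁ (proj₂ (proj₂ hasType)) largest))

  singletons≡k₁ : singletons P ≡ k Fin.zero
  singletons≡k₁ = subst (λ v → length (filter (λ B → len B ≟ v) P) ≡ k Fin.zero) i₁≡1 (block-counts Fin.zero)

period⇔largest : ∀ {n} {{_ : NonZero n}} m → 1 ≤ m → ∀ {P} → IsAPPartition m P →
  ∀ {r' i k} → HasType P r' i k → (m ∸ 1) * (lastPart r' i ∸ 1) ≤ k Fin.zero →
  ∀ {B} → B ∈ P → n ∣ len B * m ⇔ ((n ≡ lastPart r' i * m) × (len B ≡ lastPart r' i))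
period⇔largest {n} m m≥1 {P} isPartition hasType k₁-bound {B} B∈P = mk⇔ forward backward
  where
  open Partitions n m isPartition
  open TypeFacts hasType
  open Sizes (len {n})

  forward : n ∣ len B * m → (n ≡ I * m) × (len B ≡ I)
  forward n∣Lm = sym (∣-between n∣Im 0<Im (<2*-bound m≥1 largest≥2 fits)) , L≡I
    where
    -- A block of length I fits into the period L, and L ≤ I anyway.
    L≡I : len B ≡ I
    L≡I with largest-occurs
    ... | C , C∈P , lenC≡I = ≤-antisym (block≤largest B∈P)
      (subst (_≤ len B) lenC≡I (blocks-within-period C∈P (All.lookup (proj₁ isPartition) B∈P) n∣Lm))
    n∣Im : n ∣ I * m
    n∣Im = subst (λ l → n ∣ l * m) L≡I n∣Lm
    0<Im : 0 < I * m
    0<Im = *-mono-≤ (≤-trans (n≤1+n 1) largest≥2) m≥1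
    L≢1 : len B ≢ 1
    L≢1 L≡1 = 1+n≰n (subst (2 ≤_) (trans (sym L≡I) L≡1) largest≥2)
    -- The k₁ singletons and B itself occupy distinct elements of ℤ_n.
    fits : (m ∸ 1) * (I ∸ 1) + I ≤ n
    fits = begin
      (m ∸ 1) * (I ∸ 1) + I  ≤⟨ +-monoˡ-≤ I (≤-trans k₁-bound (≤-reflexive (sym singletons≡k₁))) ⟩
      singletons P + I       ≡⟨ cong (singletons P +_) L≡I ⟨
      singletons P + len B   ≤⟨ singletons+size≤total B∈P L≢1 ⟩
      total P                ≡⟨ total-length ⟩
      n                      ∎
      where open ≤-Reasoning

  backward : (n ≡ I * m) × (len B ≡ I) → n ∣ len B * m
  backward (n≡Im , L≡I) = subst (n ∣_) (trans n≡Im (cong (_* m) (sym L≡I))) ∣-refl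

proposition2 : (n m : ℕ) {{_ : NonZero n}} → 1 ≤ m →
    (P : List (Block n)) → IsAPPartition m P →
    (r' : ℕ) (i k : Fin (suc (suc r')) → ℕ) → HasType P r' i k →
    ⌈ k Data.Fin.zero / restSum r' k ⌉ ≥ (m ∸ 1) * (lastPart r' i ∸ 1) →
    (B : Block n) → B ∈ P →
    NotUniquelyDetermined m B ⇔ ((n ≡ lastPart r' i * m) × (len B ≡ lastPart r' i))
proposition2 n m m≥1 P isPartition r' i k hasType ceil-bound B B∈P =
  period⇔largest m m≥1 isPartition hasType k₁-bound B∈P ⇔-∘ nud⇔period B∈P
  where
  open Partitions n m isPartition
  -- Only the weaker consequence k₁ ≥ (m-1)(i_r-1) of the hypothesis is needed.
  k₁-bound : (m ∸ 1) * (lastPart r' i ∸ 1) ≤ k Fin.zero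
  k₁-bound = ≤-trans ceil-bound (⌈/⌉≤ (k Fin.zero) (restSum r' k))
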